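{- Let $n\geq 3$, let $M_n=(V,E)$ be the Möbius ladder of order $2n$, and let $\{u,v\}\subseteq V$ be a near-antipodal pair. Then the induced subgraph $M_n[V\setminus\{u,v\}]$ is bipartite.
   Context: The Möbius ladder $M_n$ of order $2n$ is the cubic graph obtained from a cycle of length $2n$ (its rim) by adding the $n$ edges (rungs) joining each pair of vertices at distance $n$ along the cycle. A pair of vertices $\{u,v\}$ is near-antipodal if the shortest path from $u$ to $v$ along the rim has length $n-1$. -}

module Defs where

open import Data.Nat using (ℕ; _+_; _*_; _∸_; _⊓_; ∣_-_∣)
open import Data.Fin using (Fin; toℕ)
open import Data.Bool using (Bool)
open import Data.Sum using (_⊎_)
open import Data.Product using (∃)
open import Relation.Binary.PropositionalEquality using (_≡_; _≢_)

-- Vertices of the Möbius ladder M n : the 2n rim-cycle vertices 0,…,2n-1 in cyclic order.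
Vertex : ℕ → Set
Vertex n = Fin (2 * n)

rimDist : (n : ℕ) → Vertex n → Vertex n → ℕ
rimDist n i j = ∣ toℕ i - toℕ j ∣ ⊓ (2 * n ∸ ∣ toℕ i - toℕ j ∣)

-- Edges of M n: rim edges (consecutive vertices on the cycle) and
-- rungs (pairs of vertices at distance n along the cycle).
Adj : (n : ℕ) → Vertex n → Vertex n → Set
Adj n i j = (rimDist n i j ≡ 1) ⊎ (rimDist n i j ≡ n)

NearAntipodal : (n : ℕ) → Vertex n → Vertex n → Set
NearAntipodal n u v = rimDist n u v ≡ n ∸ 1

BipartiteMinus : (n : ℕ) → Vertex n → Vertex n → Set
BipartiteMinus n u v =
  ∃ λ (c : Vertex n → Bool) →
    ∀ x y → x ≢ u → x ≢ v → y ≢ u → y ≢ v → Adj n x y → c x ≢ c y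

module Submission where

-- Number the rim vertices 0, …, 2n-1 and orient the removed
-- pair as s ≤ t.  Every edge of M n, listed with its smaller end first, is a
-- rim step (a , a+1), the closing rim edge (0 , 2n-1), or a rung (a , a+n).
-- The parity colouring x ↦ (x odd) flips along rim steps and along the
-- closing edge (2n-1 is odd), and along rungs exactly when n is odd.  When n
-- is even we additionally flip the colour on the open rim arc (s , t).  Since
-- {s , t} is near-antipodal, t - s = n ∓ 1, so every rung avoiding s and t has
-- exactly one end inside the arc, while rim edges avoiding s and t have both
-- or neither end inside it.  Hence this "twisted parity" colouring is proper
-- on M n minus {s , t}.

open import Defs
open import Data.Nat using (ℕ; _≤_)
open import Data.Nat.Base using (zero; suc; _+_; _*_; _∸_; _⊓_; _<_; _<?_)
open import Data.Nat.Properties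
open import Data.Fin using (toℕ)
open import Data.Fin.Properties using (toℕ<n; toℕ-injective)
open import Data.Bool using (Bool; true; false; not; _∧_; _xor_)
open import Data.Bool.Properties
  using (not-distribˡ-xor; not-distribʳ-xor; xor-identityʳ; xor-same; ∧-zeroʳ; not-injective; not-¬)
open import Data.Sum using (_⊎_; inj₁; inj₂)
import Data.Sum as Sum
open import Data.Product using (_×_; _,_)
open import Function using (_∘_)
open import Function.Bundles using (mk⇔)
open import Relation.Nullary using (¬_; Dec; does; ¬?; _×-dec_)
open import Relation.Nullary.Decidable using (dec-false; does-⇔)
open import Relation.Binary.PropositionalEquality

double : ∀ n → 2 * n ≡ n + n
double n = cong (n +_) (+-identityʳ n)

min-cases : ∀ {N d k} → d ≤ N → d ⊓ (N ∸ d) ≡ k → d ≡ k ⊎ d + k ≡ N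
min-cases {N} {d} {k} d≤N min≡k with ⊓-sel d (N ∸ d)
... | inj₁ min≡d = inj₁ (trans (sym min≡d) min≡k)
... | inj₂ min≡N∸d = inj₂ (begin
  d + k        ≡⟨ cong (d +_) (trans (sym min≡k) min≡N∸d) ⟩
  d + (N ∸ d)  ≡⟨ m+[n∸m]≡n d≤N ⟩
  N            ∎)
  where open ≡-Reasoning

rimDist-gap : ∀ {n k} (i j : Vertex n) → toℕ i ≤ toℕ j → rimDist n i j ≡ k →
  toℕ j ∸ toℕ i ≡ k ⊎ (toℕ j ∸ toℕ i) + k ≡ 2 * n
rimDist-gap {n} i j i≤j dist≡k =
  min-cases gap≤2n (subst (λ d → d ⊓ (2 * n ∸ d) ≡ _) (m≤n⇒∣m-n∣≡n∸m i≤j) dist≡k)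
  where
  gap≤2n : toℕ j ∸ toℕ i ≤ 2 * n
  gap≤2n = ≤-trans (m∸n≤m (toℕ j) (toℕ i)) (<⇒≤ (toℕ<n j))

rimDist-comm : ∀ n (i j : Vertex n) → rimDist n i j ≡ rimDist n j i
rimDist-comm n i j = cong (λ d → d ⊓ (2 * n ∸ d)) (∣-∣-comm (toℕ i) (toℕ j))

Adj-sym : ∀ {n} (i j : Vertex n) → Adj n i j → Adj n j i
Adj-sym {n} i j = Sum.map (trans (rimDist-comm n j i)) (trans (rimDist-comm n j i))

data OrderedEdge (n : ℕ) : ℕ → ℕ → Set where
  step : ∀ a → OrderedEdge n a (suc a)
  wrap : ∀ b → suc b ≡ 2 * n → OrderedEdge n 0 b
  rung : ∀ a → OrderedEdge n a (a + n)

gap⇒edge : ∀ {n a d} → a + d < 2 * n →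
  (d ≡ 1 ⊎ d + 1 ≡ 2 * n) ⊎ (d ≡ n ⊎ d + n ≡ 2 * n) → OrderedEdge n a (a + d)
gap⇒edge {n} {a} _ (inj₁ (inj₁ refl)) = subst (OrderedEdge n a) (+-comm 1 a) (step a)
gap⇒edge {n} {a} {d} a+d<2n (inj₁ (inj₂ d+1≡2n)) with a≡0
  where
  -- a + d < 2n = d + 1 leaves no room for a positive a.
  a≡0 : a ≡ 0
  a≡0 = n≤0⇒n≡0 (+-cancelʳ-≤ d a 0 (≤-pred a+d<1+d))
    where
    a+d<1+d : a + d < suc d
    a+d<1+d = subst (a + d <_) (trans (sym d+1≡2n) (+-comm d 1)) a+d<2n
... | refl = wrap d (trans (+-comm 1 d) d+1≡2n)
gap⇒edge {n} {a} _ (inj₂ (inj₁ refl)) = rung a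
gap⇒edge {n} {a} {d} _ (inj₂ (inj₂ d+n≡2n)) with +-cancelʳ-≡ n d n (trans d+n≡2n (double n))
... | refl = rung a

adj⇒edge : ∀ {n} (x y : Vertex n) → toℕ x ≤ toℕ y → Adj n x y → OrderedEdge n (toℕ x) (toℕ y)
adj⇒edge {n} x y x≤y adj =
  subst (OrderedEdge n (toℕ x)) y≡x+gap
    (gap⇒edge (subst (_< 2 * n) (sym y≡x+gap) (toℕ<n y))
              (Sum.map (rimDist-gap {n} {1} x y x≤y) (rimDist-gap {n} {n} x y x≤y) adj))
  where
  y≡x+gap : toℕ x + (toℕ y ∸ toℕ x) ≡ toℕ y
  y≡x+gap = m+[n∸m]≡n x≤y

-- The removed pair s ≤ t splits the rim into arcs of lengths n ∓ 1:
-- n - 1 ≤ t - s ≤ n + 1.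
HalfApart : ℕ → ℕ → ℕ → Set
HalfApart n s t = s + n ≤ suc t × t ≤ suc (s + n)

gap⇒halfApart : ∀ {m s d} → d ≡ m ⊎ d + m ≡ 2 * suc m → HalfApart (suc m) s (s + d)
gap⇒halfApart {m} {s} (inj₁ refl) =
  ≤-reflexive (+-suc s m) , ≤-trans (+-monoʳ-≤ s (n≤1+n m)) (n≤1+n (s + suc m))
gap⇒halfApart {m} {s} {d} (inj₂ d+m≡2n) with +-cancelʳ-≡ m d (suc (suc m)) d+m≡2+m+m
  where
  d+m≡2+m+m : d + m ≡ suc (suc m) + m
  d+m≡2+m+m = trans d+m≡2n (trans (double (suc m)) (cong suc (+-suc m m)))
... | refl = ≤-trans (+-monoʳ-≤ s (n≤1+n (suc m))) (n≤1+n _) , ≤-reflexive (+-suc s (suc m))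

nearAntipodal⇒halfApart : ∀ {n} (u v : Vertex n) → toℕ u ≤ toℕ v →
  NearAntipodal n u v → HalfApart n (toℕ u) (toℕ v)
nearAntipodal⇒halfApart {suc m} u v u≤v near =
  subst (HalfApart (suc m) (toℕ u)) (m+[n∸m]≡n u≤v)
    (gap⇒halfApart (rimDist-gap {suc m} {m} u v u≤v near))

InArc : ℕ → ℕ → ℕ → Set
InArc s t x = s < x × x < t

inArc? : ∀ s t x → Dec (InArc s t x)
inArc? s t x = (s <? x) ×-dec (x <? t)

inArc : ℕ → ℕ → ℕ → Bool
inArc s t x = does (inArc? s t x)

inArc-step : ∀ {s t a} → a ≢ s → suc a ≢ t → inArc s t (suc a) ≡ inArc s t a
inArc-step {s} {t} {a} a≢s 1+a≢t = does-⇔ (mk⇔ leave enter) (inArc? s t (suc a)) (inArc? s t a)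
  where
  leave : InArc s t (suc a) → InArc s t a
  leave (s<1+a , 1+a<t) = ≤∧≢⇒< (≤-pred s<1+a) (a≢s ∘ sym) , <⇒≤ 1+a<t
  enter : InArc s t a → InArc s t (suc a)
  enter (s<a , a<t) = m<n⇒m<1+n s<a , ≤∧≢⇒< a<t 1+a≢t

inArc-zero : ∀ {s t} → inArc s t 0 ≡ false
inArc-zero {s} {t} = dec-false (inArc? s t 0) (λ (s<0 , _) → n≮0 s<0)

inArc-beyond : ∀ {s t b} → t ≤ b → inArc s t b ≡ false
inArc-beyond {s} {t} {b} t≤b = dec-false (inArc? s t b) (λ (_ , b<t) → <⇒≱ b<t t≤b)

inArc-rung : ∀ {n s t a} → HalfApart n s t → t < 2 * n → a < n →
  a ≢ s → a ≢ t → a + n ≢ s → a + n ≢ t →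
  inArc s t (a + n) ≡ not (inArc s t a)
inArc-rung {n} {s} {t} {a} (lo , hi) t<2n a<n a≢s a≢t a+n≢s a+n≢t =
  does-⇔ (mk⇔ far⇒outside outside⇒far) (inArc? s t (a + n)) (¬? (inArc? s t a))
  where
  -- An end inside the arc sends its partner past t.
  far⇒outside : InArc s t (a + n) → ¬ InArc s t a
  far⇒outside (_ , a+n<t) (s<a , _) = <⇒≱ a+n<t (≤-trans hi (+-monoˡ-≤ n s<a))
  -- An end outside the arc lies before s (the arc reaches beyond n - 1),
  -- and then its partner lies inside.
  outside⇒far : ¬ InArc s t a → InArc s t (a + n)
  outside⇒far ¬inside = s<a+n , a+n<t
    where
    a<t : a < t
    a<t = ≤∧≢⇒< (≤-pred (≤-trans a<n (≤-trans (m≤n+m n s) lo))) a≢t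
    a<s : a < s
    a<s = ≤∧≢⇒< (≮⇒≥ (λ s<a → ¬inside (s<a , a<t))) a≢s
    s≤n : s ≤ n
    s≤n = +-cancelʳ-≤ n s n (≤-trans lo (subst (suc t ≤_) (double n) t<2n))
    s<a+n : s < a + n
    s<a+n = ≤∧≢⇒< (≤-trans s≤n (m≤n+m n a)) (a+n≢s ∘ sym)
    a+n<t : a + n < t
    a+n<t = ≤∧≢⇒< (≤-pred (≤-trans (+-monoˡ-≤ n a<s) lo)) a+n≢t

odd : ℕ → Bool
odd zero    = false
odd (suc x) = not (odd x)

odd-+ : ∀ a b → odd (a + b) ≡ odd a xor odd b
odd-+ zero    b = refl
odd-+ (suc a) b = trans (cong not (odd-+ a b)) (not-distribˡ-xor (odd a) (odd b))

odd-double : ∀ n → odd (2 * n) ≡ false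
odd-double n = trans (cong odd (double n)) (trans (odd-+ n n) (xor-same (odd n)))

twisted : ℕ → (ℕ → Bool) → ℕ → Bool
twisted n A x = odd x xor (not (odd n) ∧ A x)

twisted-step : ∀ n A a → A (suc a) ≡ A a → twisted n A (suc a) ≡ not (twisted n A a)
twisted-step n A a same = trans (cong (λ z → not (odd a) xor (not (odd n) ∧ z)) same)
                                (sym (not-distribˡ-xor (odd a) _))

twisted-wrap : ∀ n A b → suc b ≡ 2 * n → A 0 ≡ false → A b ≡ false →
  twisted n A b ≡ not (twisted n A 0)
twisted-wrap n A b 1+b≡2n A0 Ab rewrite A0 | Ab | ∧-zeroʳ (not (odd n)) =
  trans (xor-identityʳ (odd b)) (not-injective (trans (cong odd 1+b≡2n) (odd-double n)))

twisted-rung : ∀ n A a → A (a + n) ≡ not (A a) → twisted n A (a + n) ≡ not (twisted n A a)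
twisted-rung n A a opposite rewrite odd-+ a n | opposite with odd n
... | true  = trans (xor-identityʳ _) (sym (not-distribʳ-xor (odd a) false))
... | false = trans (cong (_xor not (A a)) (xor-identityʳ (odd a)))
                    (sym (not-distribʳ-xor (odd a) (A a)))

arcColour : ℕ → ℕ → ℕ → ℕ → Bool
arcColour n s t = twisted n (inArc s t)

arcColour-flips : ∀ {n s t a b} → HalfApart n s t → t < 2 * n → b < 2 * n →
  a ≢ s → a ≢ t → b ≢ s → b ≢ t → OrderedEdge n a b →
  arcColour n s t b ≡ not (arcColour n s t a)
arcColour-flips {n} {s} {t} _ _ _ a≢s _ _ 1+a≢t (step a) =
  twisted-step n (inArc s t) a (inArc-step a≢s 1+a≢t)
arcColour-flips {n} {s} {t} _ t<2n _ _ _ _ _ (wrap b 1+b≡2n) =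
  twisted-wrap n (inArc s t) b 1+b≡2n (inArc-zero {s} {t})
    (inArc-beyond (≤-pred (subst (t <_) (sym 1+b≡2n) t<2n)))
arcColour-flips {n} {s} {t} half t<2n a+n<2n a≢s a≢t a+n≢s a+n≢t (rung a) =
  twisted-rung n (inArc s t) a (inArc-rung half t<2n a<n a≢s a≢t a+n≢s a+n≢t)
  where
  a<n : a < n
  a<n = +-cancelʳ-< n a n (subst (a + n <_) (double n) a+n<2n)

flip⇒≢ : ∀ {p q : Bool} → q ≡ not p → p ≢ q
flip⇒≢ q≡¬p p≡q = not-¬ refl (trans p≡q q≡¬p)

ordered-bipartite : ∀ {n} (u v : Vertex n) → toℕ u ≤ toℕ v →
  NearAntipodal n u v → BipartiteMinus n u v
ordered-bipartite {n} u v u≤v near = colour , proper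
  where
  colour : Vertex n → Bool
  colour x = arcColour n (toℕ u) (toℕ v) (toℕ x)
  half : HalfApart n (toℕ u) (toℕ v)
  half = nearAntipodal⇒halfApart u v u≤v near
  flips : ∀ x y → x ≢ u → x ≢ v → y ≢ u → y ≢ v → toℕ x ≤ toℕ y → Adj n x y →
    colour y ≡ not (colour x)
  flips x y x≢u x≢v y≢u y≢v x≤y adj =
    arcColour-flips half (toℕ<n v) (toℕ<n y)
      (x≢u ∘ toℕ-injective) (x≢v ∘ toℕ-injective) (y≢u ∘ toℕ-injective) (y≢v ∘ toℕ-injective)
      (adj⇒edge x y x≤y adj)
  proper : ∀ x y → x ≢ u → x ≢ v → y ≢ u → y ≢ v → Adj n x y → colour x ≢ colour y
  proper x y x≢u x≢v y≢u y≢v adj with ≤-total (toℕ x) (toℕ y)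
  ... | inj₁ x≤y = flip⇒≢ (flips x y x≢u x≢v y≢u y≢v x≤y adj)
  ... | inj₂ y≤x = flip⇒≢ (flips y x y≢u y≢v x≢u x≢v y≤x (Adj-sym x y adj)) ∘ sym

BipartiteMinus-sym : ∀ {n} {u v : Vertex n} → BipartiteMinus n u v → BipartiteMinus n v u
BipartiteMinus-sym (colour , proper) =
  colour , λ x y x≢v x≢u y≢v y≢u → proper x y x≢u x≢v y≢u y≢v

proposition2p2 : (n : ℕ) → 3 ≤ n → (u v : Vertex n) →
    NearAntipodal n u v → BipartiteMinus n u v
proposition2p2 n _ u v near with ≤-total (toℕ u) (toℕ v)
... | inj₁ u≤v = ordered-bipartite u v u≤v near
... | inj₂ v≤u = BipartiteMinus-sym (ordered-bipartite v u v≤u (trans (rimDist-comm n v u) near))
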